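{- For $n\ge1$ let $S_n(132)$ be the set of $132$-avoiding permutations of $\{1,\dots,n\}$, and for $\sigma=\sigma_1\cdots\sigma_n$ let $\mathrm{box}(\sigma)$ be the number of indices $i$ such that $|\sigma_i-\sigma_{i+1}|=1$ or $|\sigma_{i-1}-\sigma_i|=1$ (ignoring nonexistent entries). Let $A_n(x)=\sum_{\sigma\in S_n(132)}x^{\mathrm{box}(\sigma)}$, $B_n(x)=\sum_{\sigma\in S_n(132),\sigma_1=n}x^{\mathrm{box}(\sigma)}$, $E_n(x)=\sum_{\sigma\in S_n(132),\sigma_n=n}x^{\mathrm{box}(\sigma)}$. Then for $n\ge2$ the constant terms of $A_n(x)$, $B_n(x)$ and $E_n(x)$ are all $0$.
   Context: A permutation $\sigma\in S_n$ avoids $132$ if there are no indices $i<j<k$ with $\sigma_i<\sigma_k<\sigma_j$. -}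

module Defs where

open import Data.Nat as ℕ using (ℕ; zero; suc)
import Data.Nat.Properties as ℕP
import Data.Fin
open import Data.Fin using (Fin; toℕ; fromℕ; _<_; _<?_)
open import Data.Fin.Properties using (any?; all?; _≟_)
open import Data.Vec using (Vec; []; _∷_; lookup)
open import Data.List using (List; [_]; concatMap; map; allFin; filter; length)
open import Data.Product using (∃; _×_; _,_)
open import Data.Sum using (_⊎_)
open import Relation.Nullary using (¬_; Dec)
open import Relation.Nullary.Decidable using (_×-dec_; _→-dec_; ¬?; _⊎-dec_)
open import Relation.Binary.PropositionalEquality using (_≡_)

-- A word σ = σ₁ ⋯ σₙ with letters in Fin m (values 0..m-1 stand for 1..m).
-- All words of length k over Fin m.
words : (m k : ℕ) → List (Vec (Fin m) k)
words m zero    = [ [] ]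
words m (suc k) = concatMap (λ x → map (x ∷_) (words m k)) (allFin m)

IsPerm : ∀ {n} → Vec (Fin n) n → Set
IsPerm {n} σ = ∀ (i j : Fin n) → lookup σ i ≡ lookup σ j → i ≡ j

isPerm? : ∀ {n} (σ : Vec (Fin n) n) → Dec (IsPerm σ)
isPerm? σ = all? λ i → all? λ j → (lookup σ i ≟ lookup σ j) →-dec (i ≟ j)

Avoids132 : ∀ {n} → Vec (Fin n) n → Set
Avoids132 {n} σ = ¬ (∃ λ (i : Fin n) → ∃ λ (j : Fin n) → ∃ λ (k : Fin n) →
  i < j × j < k × lookup σ i < lookup σ k × lookup σ k < lookup σ j)

avoids132? : ∀ {n} (σ : Vec (Fin n) n) → Dec (Avoids132 σ)
avoids132? σ = ¬? (any? λ i → any? λ j → any? λ k →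
  (i <? j) ×-dec (j <? k) ×-dec (lookup σ i <? lookup σ k) ×-dec (lookup σ k <? lookup σ j))

S132 : (n : ℕ) → List (Vec (Fin n) n)
S132 n = filter (λ σ → isPerm? σ ×-dec avoids132? σ) (words n n)

Adj : ∀ {n} → Fin n → Fin n → Set
Adj a b = toℕ a ≡ suc (toℕ b) ⊎ toℕ b ≡ suc (toℕ a)

adj? : ∀ {n} (a b : Fin n) → Dec (Adj a b)
adj? a b = (toℕ a ℕP.≟ suc (toℕ b)) ⊎-dec (toℕ b ℕP.≟ suc (toℕ a))

Boxed : ∀ {n} → Vec (Fin n) n → Fin n → Set
Boxed {n} σ i =
  (∃ λ (j : Fin n) → toℕ j ≡ suc (toℕ i) × Adj (lookup σ i) (lookup σ j)) ⊎
  (∃ λ (j : Fin n) → suc (toℕ j) ≡ toℕ i × Adj (lookup σ j) (lookup σ i))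

boxed? : ∀ {n} (σ : Vec (Fin n) n) (i : Fin n) → Dec (Boxed σ i)
boxed? σ i =
  (any? λ j → (toℕ j ℕP.≟ suc (toℕ i)) ×-dec adj? (lookup σ i) (lookup σ j)) ⊎-dec
  (any? λ j → (suc (toℕ j) ℕP.≟ toℕ i) ×-dec adj? (lookup σ j) (lookup σ i))

box : ∀ {n} → Vec (Fin n) n → ℕ
box {n} σ = length (filter (boxed? σ) (allFin n))

-- Coefficient of x^k in A_n(x) = Σ_{σ ∈ S_n(132)} x^{box σ}
coeffA : (n k : ℕ) → ℕ
coeffA n k = length (filter (λ σ → box σ ℕP.≟ k) (S132 n))

-- Coefficient of x^k in B_n(x) (σ₁ = n), for n = suc m
coeffB : (m k : ℕ) → ℕ
coeffB m k = length (filter (λ σ → (lookup σ Data.Fin.zero ≟ fromℕ m) ×-dec (box σ ℕP.≟ k)) (S132 (suc m)))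


-- Coefficient of x^k in E_n(x) (σₙ = n), for n = suc m
coeffE : (m k : ℕ) → ℕ
coeffE m k = length (filter (λ σ → (lookup σ (fromℕ m) ≟ fromℕ m) ×-dec (box σ ℕP.≟ k)) (S132 (suc m)))

-- Let i be the first ascent of σ (or the last position if σ is decreasing), so σ₁ > ⋯ > σᵢ,
-- and let c = σᵢ. If σᵢ₊₁ = c + 1 we are done. Otherwise c + 1 is still a value of σ (it is
-- below σᵢ₊₁, resp. σ₁), and it cannot sit after position i + 1, where it would form a 132 with
-- σᵢ σᵢ₊₁. So it lies in the decreasing run before i, whose least element is σᵢ₋₁; hence
-- σᵢ₋₁ = c + 1. Either way some index is boxed.

module Submission where

open import Defs
open import Data.Nat using (ℕ; suc; _≤_)
open import Data.Product using (_×_)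
open import Relation.Binary.PropositionalEquality using (_≡_)

import Data.Nat as ℕ
import Data.Nat.Properties as ℕP
open import Data.Fin as F using (Fin; zero; suc; toℕ; fromℕ<; inject₁; punchOut)
open import Data.Fin.Properties
  using (any?; pigeonhole; punchOut-injective; toℕ-injective; toℕ-fromℕ<; toℕ-inject₁; toℕ<n; <-cmp; <⇒≢)
open import Data.Vec using (Vec; lookup)
open import Data.List using (length)
open import Data.List.Properties using (filter-some; filter-none)
open import Data.List.Relation.Unary.All as All using (All)
open import Data.List.Relation.Unary.All.Properties using (all-filter)
open import Data.List.Membership.Propositional using (lose)
open import Data.List.Membership.Propositional.Properties using (∈-allFin)
open import Data.Product using (∃; ∃₂; _,_; proj₂)
open import Data.Sum using (_⊎_; inj₁; inj₂)
open import Function using (_∘_)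
open import Function.Definitions using (Injective)
open import Relation.Nullary using (yes; no; contradiction)
open import Relation.Nullary.Decidable using (_×-dec_)
open import Relation.Binary.Definitions using (tri<; tri≈; tri>)
open import Relation.Binary.PropositionalEquality using (_≢_; sym; trans; cong; subst)

injective⇒surjective : ∀ {n} {f : Fin n → Fin n} → Injective _≡_ _≡_ f → ∀ v → ∃ λ i → f i ≡ v
injective⇒surjective {suc n} {f} inj v with any? (λ i → f i F.≟ v)
... | yes hit = hit
... | no miss =
  let v≢f : ∀ i → v ≢ f i
      v≢f i e = miss (i , sym e)
      (i , j , i<j , same) = pigeonhole (ℕP.n<1+n n) (λ i → punchOut (v≢f i))
  in contradiction (inj (punchOut-injective (v≢f i) (v≢f j) same)) (<⇒≢ i<j)

predecessor : ∀ {n} {j i : Fin n} → j F.< i → ∃ λ (p : Fin n) → suc (toℕ p) ≡ toℕ i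
predecessor {i = zero}  ()
predecessor {i = suc i} _ = inject₁ i , cong suc (toℕ-inject₁ i)

toℕ-fromℕ<-suc : ∀ {t n} (t<n : t ℕ.< n) (t+1<n : suc t ℕ.< n) →
                 suc (toℕ (fromℕ< t<n)) ≡ toℕ (fromℕ< t+1<n)
toℕ-fromℕ<-suc t<n t+1<n = trans (cong suc (toℕ-fromℕ< t<n)) (sym (toℕ-fromℕ< t+1<n))

module _ {n} (f : Fin n → ℕ) where

  DescendingUpTo : Fin n → Set
  DescendingUpTo i = ∀ {j k} → j F.< k → k F.≤ i → f k ℕ.< f j

  FirstAscent : Set
  FirstAscent = ∃₂ λ i i′ → suc (toℕ i) ≡ toℕ i′ × DescendingUpTo i × f i ℕ.≤ f i′

  descendingUpTo-≤ : ∀ {i j k} → DescendingUpTo i → j F.≤ k → k F.≤ i → f k ℕ.≤ f j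
  descendingUpTo-≤ desc j≤k k≤i with ℕP.m≤n⇒m<n∨m≡n j≤k
  ... | inj₁ j<k = ℕP.<⇒≤ (desc j<k k≤i)
  ... | inj₂ j≡k = ℕP.≤-reflexive (cong f (toℕ-injective (sym j≡k)))

  descendingUpTo-start : ∀ {i} → toℕ i ≡ 0 → DescendingUpTo i
  descendingUpTo-start i≡0 {k = k} j<k k≤i =
    contradiction (ℕP.<-≤-trans j<k (subst (toℕ k ℕ.≤_) i≡0 k≤i)) ℕP.n≮0

  descendingUpTo-next : ∀ {i i′} → DescendingUpTo i → suc (toℕ i) ≡ toℕ i′ →
                        f i′ ℕ.< f i → DescendingUpTo i′
  descendingUpTo-next {i} desc next fi′<fi {j} {k} j<k k≤i′ with ℕP.m≤n⇒m<n∨m≡n k≤i′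
  ... | inj₁ k<i′ = desc j<k (ℕP.≤-pred (subst (suc (toℕ k) ℕ.≤_) (sym next) k<i′))
  ... | inj₂ k≡i′ = subst (λ x → f x ℕ.< f j) (sym (toℕ-injective k≡i′))
                      (ℕP.<-≤-trans fi′<fi (descendingUpTo-≤ desc j≤i ℕP.≤-refl))
    where
    j≤i : j F.≤ i
    j≤i = ℕP.≤-pred (subst (suc (toℕ j) ℕ.≤_) (trans k≡i′ (sym next)) j<k)

  descending-or-firstAscent : ∀ t (t<n : t ℕ.< n) → DescendingUpTo (fromℕ< t<n) ⊎ FirstAscent
  descending-or-firstAscent ℕ.zero t<n = inj₁ (descendingUpTo-start (toℕ-fromℕ< t<n))
  descending-or-firstAscent (suc t) t+1<n
    with t<n ← ℕP.<-trans (ℕP.n<1+n t) t+1<n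
    with descending-or-firstAscent t t<n
  ... | inj₂ ascent = inj₂ ascent
  ... | inj₁ desc with f (fromℕ< t+1<n) ℕP.<? f (fromℕ< t<n)
  ...   | yes descent = inj₁ (descendingUpTo-next desc (toℕ-fromℕ<-suc t<n t+1<n) descent)
  ...   | no ¬descent = inj₂ (_ , _ , toℕ-fromℕ<-suc t<n t+1<n , desc , ℕP.≮⇒≥ ¬descent)

  descendingUpTo-predecessor : ∀ {i j k} → DescendingUpTo i → suc (toℕ j) ≡ toℕ i →
                               k F.< i → f k ≡ suc (f i) → f j ≡ suc (f i)
  descendingUpTo-predecessor {i} {j} {k} desc prev k<i fk≡ =
    ℕP.≤-antisym fj≤fi+1 (desc j<i ℕP.≤-refl)
    where
    j<i : j F.< i
    j<i = ℕP.≤-reflexive prev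
    fj≤fi+1 : f j ℕ.≤ suc (f i)
    fj≤fi+1 = subst (f j ℕ.≤_) fk≡
      (descendingUpTo-≤ desc (ℕP.≤-pred (subst (suc (toℕ k) ℕ.≤_) (sym prev) k<i)) (ℕP.<⇒≤ j<i))

value : ∀ {n} → Vec (Fin n) n → Fin n → ℕ
value σ i = toℕ (lookup σ i)

module _ {n} (σ : Vec (Fin n) n) (perm : IsPerm σ) (avoids : Avoids132 σ) where

  position-of-succ : ∀ {i j} → value σ i ℕ.< value σ j → ∃ λ k → value σ k ≡ suc (value σ i)
  position-of-succ {i} {j} vi<vj
    with k , σk≡ ← injective⇒surjective (λ {x} {y} → perm x y)
                                         (fromℕ< (ℕP.≤-<-trans vi<vj (toℕ<n (lookup σ j))))
    = k , trans (cong toℕ σk≡) (toℕ-fromℕ< _)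

  succ-position-≢ : ∀ {i k} → value σ k ≡ suc (value σ i) → k ≢ i
  succ-position-≢ vk≡ k≡i = ℕP.1+n≢n (trans (sym vk≡) (cong (value σ) k≡i))

  successive-values-≢ : ∀ {i i′} → suc (toℕ i) ≡ toℕ i′ → value σ i ≢ value σ i′
  successive-values-≢ {i} {i′} next e =
    ℕP.1+n≢n (trans next (cong toℕ (sym (perm i i′ (toℕ-injective e)))))

  boxed-if-succ-before : ∀ {i k} → DescendingUpTo (value σ) i → k F.< i →
                         value σ k ≡ suc (value σ i) → Boxed σ i
  boxed-if-succ-before desc k<i vk≡ with j , prev ← predecessor k<i =
    inj₂ (j , prev , inj₁ (descendingUpTo-predecessor (value σ) desc prev k<i vk≡))

  boxed-at-descending-end : ∀ {i j} → DescendingUpTo (value σ) i → j F.< i → (∀ k → k F.≤ i) → Boxed σ i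
  boxed-at-descending-end desc j<i i-last with k , vk≡ ← position-of-succ (desc j<i ℕP.≤-refl) =
    boxed-if-succ-before desc (ℕP.≤∧≢⇒< (i-last k) (succ-position-≢ vk≡ ∘ toℕ-injective)) vk≡

  boxed-at-ascent : ∀ {i i′} → suc (toℕ i) ≡ toℕ i′ → DescendingUpTo (value σ) i →
                    value σ i ℕ.≤ value σ i′ → ∃ (Boxed σ)
  boxed-at-ascent {i} {i′} next desc vi≤vi′ with value σ i′ ℕP.≟ suc (value σ i)
  ... | yes vi′≡ = i , inj₁ (i′ , sym next , inj₂ vi′≡)
  ... | no vi′≢
    with vi<vi′ ← ℕP.≤∧≢⇒< vi≤vi′ (successive-values-≢ next)
    with k , vk≡ ← position-of-succ vi<vi′ | <-cmp k i
  ...   | tri< k<i _ _ = i , boxed-if-succ-before desc k<i vk≡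
  ...   | tri≈ _ k≡i _ = contradiction k≡i (succ-position-≢ vk≡)
  ...   | tri> _ _ i<k =
    contradiction (i , i′ , k , ℕP.≤-reflexive next , i′<k , vi<vk , vk<vi′) avoids
    where
    i′<k : i′ F.< k
    i′<k = ℕP.≤∧≢⇒< (subst (ℕ._≤ toℕ k) next i<k)
                     (λ e → vi′≢ (trans (cong (value σ) (toℕ-injective e)) vk≡))
    vi<vk : value σ i ℕ.< value σ k
    vi<vk = subst (value σ i ℕ.<_) (sym vk≡) (ℕP.n<1+n _)
    vk<vi′ : value σ k ℕ.< value σ i′
    vk<vi′ = subst (ℕ._< value σ i′) (sym vk≡) (ℕP.≤∧≢⇒< vi<vi′ (vi′≢ ∘ sym))

boxed-exists : ∀ {m} (σ : Vec (Fin (suc m)) (suc m)) → IsPerm σ → Avoids132 σ → 1 ≤ m → ∃ (Boxed σ)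
boxed-exists {m} σ perm avoids 1≤m with descending-or-firstAscent (value σ) m (ℕP.n<1+n m)
... | inj₁ desc = last , boxed-at-descending-end σ perm avoids {j = zero} desc 0<last last-max
  where
  last : Fin (suc m)
  last = fromℕ< (ℕP.n<1+n m)
  last≡m : toℕ last ≡ m
  last≡m = toℕ-fromℕ< (ℕP.n<1+n m)
  0<last : 0 ℕ.< toℕ last
  0<last = subst (0 ℕ.<_) (sym last≡m) 1≤m
  last-max : ∀ k → k F.≤ last
  last-max k = subst (toℕ k ℕ.≤_) (sym last≡m) (ℕP.≤-pred (toℕ<n k))
... | inj₂ (_ , _ , next , desc , ascent) = boxed-at-ascent σ perm avoids next desc ascent

boxed⇒box≢0 : ∀ {n} {σ : Vec (Fin n) n} {i} → Boxed σ i → box σ ≢ 0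
boxed⇒box≢0 {σ = σ} {i} b box≡0 = ℕP.<-irrefl (sym box≡0) (filter-some (boxed? σ) (lose (∈-allFin i) b))

S132-box≢0 : ∀ m → 1 ≤ m → All (λ σ → box σ ≢ 0) (S132 (suc m))
S132-box≢0 m 1≤m =
  All.map (λ { {σ} (perm , avoids) → boxed⇒box≢0 {σ = σ} (proj₂ (boxed-exists σ perm avoids 1≤m)) })
          (all-filter (λ σ → isPerm? σ ×-dec avoids132? σ) (words (suc m) (suc m)))

theorem2 : ∀ (m : ℕ) → 1 ≤ m →
    coeffA (suc m) 0 ≡ 0 × coeffB m 0 ≡ 0 × coeffE m 0 ≡ 0
theorem2 m 1≤m =
  cong length (filter-none _ box≢0) ,
  cong length (filter-none _ (All.map (_∘ proj₂) box≢0)) ,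
  cong length (filter-none _ (All.map (_∘ proj₂) box≢0))
  where
  box≢0 : All (λ σ → box σ ≢ 0) (S132 (suc m))
  box≢0 = S132-box≢0 m 1≤m
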